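{- Let $\mathbf{p}=p_{n-1}\dots p_0$ be an $(m,n)$-parking function and $\Delta$ a bounded, co-bounded $m$-invariant set with $\mathbf{p}\cdot\Delta=\Delta+n$. For $0\le i\le n$ put $\Delta^{(i)}=p_{i-1}\cdots p_0\cdot\Delta$ (so $\Delta^{(0)}=\Delta$). Then $\Delta^{(i)}$ is an $(m,n)$-invariant set for every $0\le i\le n$.
   Context: $[m]=\{0,\dots,m-1\}$. $\Delta\subset\mathbb{Z}$ is $k$-invariant if $\Delta+k\subset\Delta$, $(m,n)$-invariant if $m$- and $n$-invariant; bounded = has a minimum, co-bounded = contains $\mathbb{Z}_{\ge K}$ for some $K$. The $m$-generators of an $m$-invariant $\Delta$ are the elements of $\Delta\setminus(\Delta+m)=\{a_0<\dots<a_{m-1}\}$; a letter $j\in[m]$ acts by $j\cdot\Delta=\Delta\setminus\{a_j\}$, and words act from right to left (letter $p_0$ first). An $(m,n)$-parking function is $\mathbf{p}=p_{n-1}\dots p_0\in[m]^n$ with $\#\{j:p_j<i\}\ge in/m$ for $1\le i\le m$. -}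

module Defs where

open import Data.Bool using (Bool; true; false; _∧_; not; if_then_else_)
open import Data.Nat as ℕ using (ℕ; zero; suc; _<ᵇ_)
open import Data.Fin using (Fin; toℕ; inject₁; fromℕ)
import Data.Fin as F
open import Data.Integer as ℤ using (ℤ; +_; _-_; _+_; _<_)
open import Data.Product using (Σ; _×_)
open import Relation.Nullary.Decidable using (⌊_⌋)
open import Relation.Binary.PropositionalEquality using (_≡_)

ZSet : Set
ZSet = ℤ → Bool

shift : ZSet → ℕ → ZSet
shift Δ k x = Δ (x - + k)

Invariant : ℕ → ZSet → Set
Invariant k Δ = ∀ x → Δ x ≡ true → Δ (x + + k) ≡ true

LowerBound : ZSet → ℤ → Set
LowerBound Δ L = ∀ x → x < L → Δ x ≡ false

Bounded : ZSet → Set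
Bounded Δ = Σ ℤ λ a → Δ a ≡ true × LowerBound Δ a

CoBounded : ZSet → Set
CoBounded Δ = Σ ℤ λ K → ∀ (t : ℕ) → Δ (K + + t) ≡ true

isGen : ℕ → ZSet → ℤ → Bool
isGen m Δ x = Δ x ∧ not (Δ (x - + m))

countUpTo : (ℕ → Bool) → ℕ → ℕ
countUpTo f zero = zero
countUpTo f (suc k) = countUpTo f k ℕ.+ (if f k then 1 else 0)

-- a is the j-th (0-indexed, increasing order) m-generator a_j of Δ:
-- a is a generator, and exactly j generators lie below a
-- (counted on a window [L, a) with L below every element of Δ).
JthGen : ℕ → ZSet → ℕ → ℤ → Set
JthGen m Δ j a =
  isGen m Δ a ≡ true ×
  Σ ℤ λ L → Σ ℕ λ k →
    (a ≡ L + + k) × LowerBound Δ L ×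
    (countUpTo (λ t → isGen m Δ (L + + t)) k ≡ j)

Act : (m : ℕ) → Fin m → ZSet → ZSet → Set
Act m j Δ Δ' = Σ ℤ λ a → JthGen m Δ (toℕ j) a ×
  (∀ x → Δ' x ≡ (Δ x ∧ not ⌊ x ℤ.≟ a ⌋))

countFin : {n : ℕ} → (Fin n → Bool) → ℕ
countFin {zero} f = zero
countFin {suc n} f = (if f F.zero then 1 else 0) ℕ.+ countFin (λ j → f (F.suc j))

-- p = p_{n-1} … p_0, stored as p : Fin n → Fin m with p i = p_i.
-- (m,n)-parking: #{j : p_j < i} ≥ i n / m for 1 ≤ i ≤ m,
-- written multiplicatively as i * n ≤ m * #{j : p_j < i}.
ParkingFunction : (m n : ℕ) → (Fin n → Fin m) → Set
ParkingFunction m n p = ∀ i → 1 ℕ.≤ i → i ℕ.≤ m →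
  i ℕ.* n ℕ.≤ m ℕ.* countFin (λ j → toℕ (p j) <ᵇ i)

-- D is the chain of intermediate sets: D 0 = Δ, D (i+1) = p_i · D i.
-- Thus D i = p_{i-1} ⋯ p_0 · Δ = Δ^{(i)}.
IsChain : (m n : ℕ) → (Fin n → Fin m) → ZSet → (Fin (suc n) → ZSet) → Set
IsChain m n p Δ D =
  (∀ x → D F.zero x ≡ Δ x) ×
  (∀ (i : Fin n) → Act m (p i) (D (inject₁ i)) (D (F.suc i)))

{-# OPTIONS --safe #-}
-- Each letter removes an m-generator a of the current set; as a − m lies outside that set, no x
-- with x + m = a survives, so m-invariance is preserved along the chain.  The chain decreases, so
-- Δ + n = Δ⁽ⁿ⁾ ⊆ Δ⁽ⁱ⁾ ⊆ Δ, and any Γ squeezed as Δ + n ⊆ Γ ⊆ Δ is n-invariant.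
module Submission where

open import Defs
open import Data.Nat using (ℕ; suc)
open import Data.Fin using (Fin; fromℕ; inject₁)
import Data.Fin as F
open import Data.Fin.Induction using (<-weakInduction; >-weakInduction)
open import Data.Product using (_×_; _,_)
open import Data.Bool using (true; false; _∧_; not)
open import Data.Bool.Properties using (∧-conicalˡ; ∧-conicalʳ)
open import Data.Integer as ℤ using (+_; _+_)
open import Data.Integer.Properties using (+-0-abelianGroup)
open import Algebra.Properties.AbelianGroup +-0-abelianGroup using (//-rightDividesʳ)
open import Relation.Nullary.Decidable using (⌊_⌋; isYes≗does; dec-false)
open import Relation.Binary.PropositionalEquality

infix 4 _⊆_
_⊆_ : ZSet → ZSet → Set
Γ ⊆ Δ = ∀ x → Γ x ≡ true → Δ x ≡ true

≗⇒⊆ : ∀ {Γ Δ} → Γ ≗ Δ → Γ ⊆ Δ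
≗⇒⊆ Γ≗Δ x x∈Γ = trans (sym (Γ≗Δ x)) x∈Γ

⊆-trans : ∀ {Γ Δ Θ} → Γ ⊆ Δ → Δ ⊆ Θ → Γ ⊆ Θ
⊆-trans Γ⊆Δ Δ⊆Θ x x∈Γ = Δ⊆Θ x (Γ⊆Δ x x∈Γ)

Invariant-resp-≗ : ∀ {k Γ Δ} → Γ ≗ Δ → Invariant k Δ → Invariant k Γ
Invariant-resp-≗ {k} Γ≗Δ Δ-inv x x∈Γ = trans (Γ≗Δ (x + + k)) (Δ-inv x (≗⇒⊆ Γ≗Δ x x∈Γ))

Invariant-squeezed : ∀ {k Δ Γ} → shift Δ k ⊆ Γ → Γ ⊆ Δ → Invariant k Γ
Invariant-squeezed {k} {Δ} Δ+k⊆Γ Γ⊆Δ x x∈Γ =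
  Δ+k⊆Γ (x + + k) (trans (cong Δ (//-rightDividesʳ (+ k) x)) (Γ⊆Δ x x∈Γ))

isGen⇒∉shift : ∀ {m Δ a x} → isGen m Δ a ≡ true → Δ x ≡ true → x + + m ≢ a
isGen⇒∉shift {m} {Δ} {x = x} a-gen x∈Δ refl with () ←
  trans (sym (∧-conicalʳ _ _ a-gen)) (cong not (trans (cong Δ (//-rightDividesʳ (+ m) x)) x∈Δ))

Act⇒⊆ : ∀ {m j Δ Δ′} → Act m j Δ Δ′ → Δ′ ⊆ Δ
Act⇒⊆ (_ , _ , Δ′≗) x x∈Δ′ = ∧-conicalˡ _ _ (trans (sym (Δ′≗ x)) x∈Δ′)

Act-preserves-Invariant : ∀ {m j Δ Δ′} → Invariant m Δ → Act m j Δ Δ′ → Invariant m Δ′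
Act-preserves-Invariant {m} {Δ = Δ} {Δ′} Δ-inv act@(a , (a-gen , _) , Δ′≗) x x∈Δ′ = begin
  Δ′ (x + + m)                        ≡⟨ Δ′≗ (x + + m) ⟩
  Δ (x + + m) ∧ not ⌊ x + + m ℤ.≟ a ⌋ ≡⟨ cong₂ (λ b c → b ∧ not c) (Δ-inv x x∈Δ) a-not-hit ⟩
  true                                ∎
  where
  open ≡-Reasoning
  x∈Δ : Δ x ≡ true
  x∈Δ = Act⇒⊆ act x x∈Δ′
  a-not-hit : ⌊ x + + m ℤ.≟ a ⌋ ≡ false
  a-not-hit = trans (isYes≗does x+m≟a) (dec-false x+m≟a (isGen⇒∉shift {m} {Δ} a-gen x∈Δ))
    where x+m≟a = x + + m ℤ.≟ a

module _ {n} (D : Fin (suc n) → ZSet) (descending : ∀ i → D (F.suc i) ⊆ D (inject₁ i)) where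

  chain-⊆-first : ∀ i → D i ⊆ D F.zero
  chain-⊆-first = <-weakInduction (λ i → D i ⊆ D F.zero)
    (λ _ x∈D₀ → x∈D₀) (λ i Dᵢ⊆D₀ → ⊆-trans (descending i) Dᵢ⊆D₀)

  last-⊆-chain : ∀ i → D (fromℕ n) ⊆ D i
  last-⊆-chain = >-weakInduction (λ i → D (fromℕ n) ⊆ D i)
    (λ _ x∈Dₙ → x∈Dₙ) (λ i Dₙ⊆Dᵢ₊₁ → ⊆-trans Dₙ⊆Dᵢ₊₁ (descending i))

IsChain⇒Invariant : ∀ {m n p Δ D} → Invariant m Δ → IsChain m n p Δ D → ∀ i → Invariant m (D i)
IsChain⇒Invariant {m} {D = D} Δ-inv (D₀≗Δ , step) = <-weakInduction (λ i → Invariant m (D i))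
  (Invariant-resp-≗ D₀≗Δ Δ-inv) (λ i Dᵢ-inv → Act-preserves-Invariant Dᵢ-inv (step i))

mainTheorem5 : (m n : ℕ) (p : Fin n → Fin m) (Δ : ZSet) (D : Fin (suc n) → ZSet) →
    ParkingFunction m n p →
    Bounded Δ → CoBounded Δ → Invariant m Δ →
    IsChain m n p Δ D →
    (∀ x → D (fromℕ n) x ≡ shift Δ n x) →
    ∀ (i : Fin (suc n)) → Invariant m (D i) × Invariant n (D i)
mainTheorem5 m n p Δ D _ _ _ Δ-inv chain@(D₀≗Δ , step) Dₙ≗Δ+n i =
  IsChain⇒Invariant Δ-inv chain i , Invariant-squeezed Δ+n⊆Dᵢ Dᵢ⊆Δ
  where
  descending : ∀ j → D (F.suc j) ⊆ D (inject₁ j)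
  descending j = Act⇒⊆ (step j)
  Δ+n⊆Dᵢ : shift Δ n ⊆ D i
  Δ+n⊆Dᵢ = ⊆-trans (≗⇒⊆ (λ x → sym (Dₙ≗Δ+n x))) (last-⊆-chain D descending i)
  Dᵢ⊆Δ : D i ⊆ Δ
  Dᵢ⊆Δ = ⊆-trans (chain-⊆-first D descending i) (≗⇒⊆ D₀≗Δ)
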